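{- Let $G$ be a multi-flock chicken graph and $m\geq 1$. If some flock of $G$ contains an $m$-Duke, then that flock contains a non-eclipsed $m$-Duke. Moreover, if a chicken $c$ is pecked by an $m$-Duke, then $c$ is also pecked by a non-eclipsed $m$-Duke.
   Context: A multi-flock chicken graph is a finite orientation of a complete multipartite graph; vertices are called chickens and partite sets are called flocks. "$c$ pecks $d$" means the edge between $c$ and $d$ is oriented from $c$ to $d$. A peck chain of length $m$ is a directed path with $m$ edges. A chicken $d$ is an $m$-Duke if every chicken not in the flock of $d$ can be reached from $d$ by a peck chain of length at most $m$. A chicken $e$ eclipses a chicken $d$ in the same flock if $e$ pecks every chicken that $d$ pecks and also pecks at least one chicken that $d$ does not peck. A chicken is non-eclipsed if no other chicken of its flock eclipses it. -}

module Defs where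

open import Data.Nat using (ℕ; zero; suc; _≤_)
open import Data.Fin using (Fin)
open import Data.Bool using (Bool; true; false)
open import Data.Product using (Σ; _×_; ∃; ∃-syntax; _,_)
open import Data.Sum using (_⊎_)
open import Relation.Binary.PropositionalEquality using (_≡_; _≢_)
open import Relation.Nullary using (¬_)

-- A multi-flock chicken graph: finitely many chickens (Fin n), each assigned
-- a flock (Fin k), and an orientation of the complete multipartite graph
-- given by a Boolean peck relation.
record ChickenGraph : Set where
  field
    n     : ℕ
    k     : ℕ
    flock : Fin n → Fin k
    pecks : Fin n → Fin n → Bool
    noPeckInFlock : ∀ c d → flock c ≡ flock d → pecks c d ≡ false
    oriented      : ∀ c d → flock c ≢ flock d → (pecks c d ≡ true) ⊎ (pecks d c ≡ true)
    antisym       : ∀ c d → pecks c d ≡ true → pecks d c ≡ false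

module _ (G : ChickenGraph) where
  open ChickenGraph G

  Pecks : Fin n → Fin n → Set
  Pecks c d = pecks c d ≡ true

  data PeckChain : Fin n → Fin n → ℕ → Set where
    here : ∀ {c} → PeckChain c c zero
    step : ∀ {c d e ℓ} → Pecks c d → PeckChain d e ℓ → PeckChain c e (suc ℓ)

  IsDuke : ℕ → Fin n → Set
  IsDuke m d = ∀ c → flock c ≢ flock d → ∃[ ℓ ] (ℓ ≤ m × PeckChain d c ℓ)

  Eclipses : Fin n → Fin n → Set
  Eclipses e d = flock e ≡ flock d
               × (∀ c → Pecks d c → Pecks e c)
               × ∃[ c ] (Pecks e c × ¬ Pecks d c)

  NonEclipsed : Fin n → Set
  NonEclipsed d = ∀ e → ¬ Eclipses e d

module Submission where

-- Eclipsing strictly enlarges the set of chickens pecked, so it is a well-founded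
-- relation on the finitely many chickens; following eclipsers from any chicken d
-- therefore ends at a non-eclipsed chicken d′ of the same flock that pecks everything
-- d pecks. Such a d′ starts every peck chain out of d's flock just as d does, so it
-- is an m-Duke whenever d is, and it pecks every chicken that d pecks.

open import Defs
open import Data.Nat using (ℕ; _≥_)
open import Data.Fin using (Fin)
open import Data.Fin.Properties using (_≟_; any?; all?)
open import Data.Fin.Subset using (Subset; _∈_; _⊃_)
open import Data.Fin.Subset.Induction using (⊃-wellFounded)
open import Data.Bool using (true)
open import Data.Bool.Properties using () renaming (_≟_ to _≟ᵇ_)
open import Data.Vec using (tabulate)
open import Data.Vec.Properties using ([]=⇒lookup; lookup⇒[]=; lookup∘tabulate)
open import Data.Product using (_×_; ∃-syntax; _,_)
open import Data.Empty using (⊥-elim)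
open import Induction.WellFounded using (WellFounded; Acc; acc; module Subrelation)
open import Relation.Binary.Construct.On as On using ()
open import Relation.Nullary using (Dec; yes; no; ¬?; _×-dec_; _→-dec_)
open import Relation.Binary.PropositionalEquality using (_≡_; refl; sym; trans)

module _ (G : ChickenGraph) where
  open ChickenGraph G

  Dominates : Fin n → Fin n → Set
  Dominates d′ d = flock d′ ≡ flock d × (∀ c → Pecks G d c → Pecks G d′ c)

  dominates-refl : ∀ {d} → Dominates d d
  dominates-refl = refl , λ _ d→c → d→c

  dominates-trans : ∀ {d″ d′ d} → Dominates d″ d′ → Dominates d′ d → Dominates d″ d
  dominates-trans (f″ , ⊆″) (f′ , ⊆′) = trans f″ f′ , λ c d→c → ⊆″ c (⊆′ c d→c)

  eclipses⇒dominates : ∀ {e d} → Eclipses G e d → Dominates e d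
  eclipses⇒dominates (same-flock , ⊆ , _) = same-flock , ⊆

  dominates-isDuke : ∀ {m d′ d} → Dominates d′ d → IsDuke G m d → IsDuke G m d′
  dominates-isDuke (same-flock , ⊆) duke c c∉d′ with duke c (λ c∈d → c∉d′ (trans c∈d (sym same-flock)))
  ... | _ , _  , here            = ⊥-elim (c∉d′ (sym same-flock))
  ... | ℓ , ℓ≤m , step d→e e⇝c = ℓ , ℓ≤m , step (⊆ _ d→e) e⇝c

  outNeighbourhood : Fin n → Subset n
  outNeighbourhood d = tabulate (pecks d)

  ∈-outNeighbourhood⁺ : ∀ {d c} → Pecks G d c → c ∈ outNeighbourhood d
  ∈-outNeighbourhood⁺ {d} {c} d→c = lookup⇒[]= c _ (trans (lookup∘tabulate (pecks d) c) d→c)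

  ∈-outNeighbourhood⁻ : ∀ {d c} → c ∈ outNeighbourhood d → Pecks G d c
  ∈-outNeighbourhood⁻ {d} {c} c∈d = trans (sym (lookup∘tabulate (pecks d) c)) ([]=⇒lookup c∈d)

  eclipses⇒outNeighbourhood-⊃ : ∀ {e d} → Eclipses G e d → outNeighbourhood e ⊃ outNeighbourhood d
  eclipses⇒outNeighbourhood-⊃ (_ , ⊆ , c , e→c , ¬d→c) =
      (λ c∈d → ∈-outNeighbourhood⁺ (⊆ _ (∈-outNeighbourhood⁻ c∈d)))
    , c , ∈-outNeighbourhood⁺ e→c , (λ c∈d → ¬d→c (∈-outNeighbourhood⁻ c∈d))

  eclipses-wellFounded : WellFounded (Eclipses G)
  eclipses-wellFounded = Subrelation.wellFounded eclipses⇒outNeighbourhood-⊃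
    (On.wellFounded outNeighbourhood ⊃-wellFounded)

  eclipses? : ∀ e d → Dec (Eclipses G e d)
  eclipses? e d = (flock e ≟ flock d)
          ×-dec (all? (λ c → pecks? d c →-dec pecks? e c)
          ×-dec any? (λ c → pecks? e c ×-dec ¬? (pecks? d c)))
    where
    pecks? : ∀ c d → Dec (Pecks G c d)
    pecks? c d = pecks c d ≟ᵇ true

  nonEclipsed-dominator : ∀ d → ∃[ d′ ] (Dominates d′ d × NonEclipsed G d′)
  nonEclipsed-dominator d = go d (eclipses-wellFounded d)
    where
    go : ∀ d → Acc (Eclipses G) d → ∃[ d′ ] (Dominates d′ d × NonEclipsed G d′)
    go d (acc rec) with any? (λ e → eclipses? e d)
    ... | no ¬eclipsed = d , dominates-refl , λ e e-eclipses-d → ¬eclipsed (e , e-eclipses-d)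
    ... | yes (e , e-eclipses-d) with go e (rec e-eclipses-d)
    ...   | d′ , d′≽e , nonEclipsed =
            d′ , dominates-trans d′≽e (eclipses⇒dominates e-eclipses-d) , nonEclipsed

lemma3 : (G : ChickenGraph) (m : ℕ) → m ≥ 1 →
         (∀ d → IsDuke G m d →
            ∃[ d′ ] (ChickenGraph.flock G d′ ≡ ChickenGraph.flock G d
                     × IsDuke G m d′ × NonEclipsed G d′))
         × (∀ c d → IsDuke G m d → Pecks G d c →
            ∃[ d′ ] (IsDuke G m d′ × NonEclipsed G d′ × Pecks G d′ c))
lemma3 G m _ = sameFlock , pecked
  where
  sameFlock : ∀ d → IsDuke G m d →
              ∃[ d′ ] (ChickenGraph.flock G d′ ≡ ChickenGraph.flock G d
                       × IsDuke G m d′ × NonEclipsed G d′)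
  sameFlock d duke with nonEclipsed-dominator G d
  ... | d′ , d′≽d@(same-flock , _) , nonEclipsed =
        d′ , same-flock , dominates-isDuke G d′≽d duke , nonEclipsed

  pecked : ∀ c d → IsDuke G m d → Pecks G d c →
           ∃[ d′ ] (IsDuke G m d′ × NonEclipsed G d′ × Pecks G d′ c)
  pecked c d duke d→c with nonEclipsed-dominator G d
  ... | d′ , d′≽d@(_ , ⊆) , nonEclipsed =
        d′ , dominates-isDuke G d′≽d duke , nonEclipsed , ⊆ c d→c
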